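{- For any $n,k\ge 1$ (and any $p$), $\mathcal{O}(2n,p,k)=\Omega\big(k^{ -1}\mathcal{S}(n,p,k-1)\big)$.
   Context: For a directed graph $G=(V,E)$ and $\mathcal{P}\subseteq V\times V$, a subgraph $H$ of $G$ is a $k$-fault-tolerant reachability subgraph of $G$ for $\mathcal{P}$ if for every $(s,t)\in\mathcal{P}$ and every $F\subseteq E$ with $|F|\le k$, $t$ is reachable from $s$ in $G\setminus F$ iff in $H\setminus F$ (for $k=0$ this is an ordinary reachability preserver). A $k$-fault-tolerant reachability oracle of $G$ for $\mathcal{P}$ is a data structure that, given $(s,t)\in\mathcal{P}$ and $F\subseteq E$ with $|F|\le k$, decides whether $t$ is reachable from $s$ in $G\setminus F$. $\mathcal{S}(n,p,k)$ denotes the extremal size (number of edges) of $k$-fault-tolerant reachability subgraphs over $n$-vertex directed graphs with $|\mathcal{P}|=p$ demand pairs, i.e. the maximum over such $(G,\mathcal{P})$ of the minimum size of a $k$-fault-tolerant reachability subgraph; $\mathcal{O}(n,p,k)$ denotes the analogous extremal size (in bits) of $k$-fault-tolerant reachability oracles. -}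

module Defs where

open import Data.Nat using (ℕ; zero; suc; _+_; _*_; _≤_)
open import Data.Bool using (Bool; true; false; _∧_; not; if_then_else_)
open import Data.Fin using (Fin)
open import Data.List using (List; map; allFin; length)
open import Data.Nat.ListAction using (sum)
open import Data.Product using (Σ; _×_; _,_)
open import Relation.Binary.PropositionalEquality using (_≡_)

-- A directed graph on vertex set Fin n is given by its edge set E ⊆ V × V,
-- represented as a Boolean adjacency predicate. Demand-pair sets P ⊆ V × V
-- and fault sets F ⊆ E use the same representation.
EdgeSet : ℕ → Set
EdgeSet n = Fin n → Fin n → Bool

∣_∣ₑ : ∀ {n} → EdgeSet n → ℕ
∣_∣ₑ {n} E = sum (map (λ u → sum (map (λ v → if E u v then 1 else 0) (allFin n))) (allFin n))

_⊆ₑ_ : ∀ {n} → EdgeSet n → EdgeSet n → Set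
A ⊆ₑ B = ∀ u v → A u v ≡ true → B u v ≡ true

_∖ₑ_ : ∀ {n} → EdgeSet n → EdgeSet n → EdgeSet n
(G ∖ₑ F) u v = G u v ∧ not (F u v)

data Reach {n} (E : EdgeSet n) : Fin n → Fin n → Set where
  here : ∀ {s} → Reach E s s
  step : ∀ {s u t} → E s u ≡ true → Reach E u t → Reach E s t

_⇔_ : Set → Set → Set
A ⇔ B = (A → B) × (B → A)

IsFTRS : ∀ {n} → (k : ℕ) → (G P H : EdgeSet n) → Set
IsFTRS {n} k G P H =
  H ⊆ₑ G ×
  (∀ (s t : Fin n) → P s t ≡ true →
     ∀ (F : EdgeSet n) → F ⊆ₑ G → ∣ F ∣ₑ ≤ k →
       Reach (G ∖ₑ F) s t ⇔ Reach (H ∖ₑ F) s t)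

IsMinFTRS : ∀ {n} → ℕ → EdgeSet n → EdgeSet n → ℕ → Set
IsMinFTRS {n} k G P m =
  Σ (EdgeSet n) (λ H → IsFTRS k G P H × ∣ H ∣ₑ ≡ m) ×
  (∀ (H : EdgeSet n) → IsFTRS k G P H → m ≤ ∣ H ∣ₑ)

UpperS : ℕ → ℕ → ℕ → ℕ → Set
UpperS n p k s =
  ∀ (G P : EdgeSet n) → ∣ P ∣ₑ ≡ p → ∀ m → IsMinFTRS k G P m → m ≤ s

-- s = 𝒮(n,p,k): the maximum (least upper bound, = 0 for an empty family)
IsS : ℕ → ℕ → ℕ → ℕ → Set
IsS n p k s = UpperS n p k s × (∀ s′ → UpperS n p k s′ → s ≤ s′)

OracleScheme : ℕ → ℕ → ℕ → ℕ → Set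
OracleScheme n p k b =
  Σ (List Bool → Fin n → Fin n → EdgeSet n → Bool) λ D →
    ∀ (G P : EdgeSet n) → ∣ P ∣ₑ ≡ p →
      Σ (List Bool) λ w → length w ≤ b ×
        (∀ (s t : Fin n) → P s t ≡ true →
           ∀ (F : EdgeSet n) → F ⊆ₑ G → ∣ F ∣ₑ ≤ k →
             (D w s t F ≡ true) ⇔ Reach (G ∖ₑ F) s t)

IsO : ℕ → ℕ → ℕ → ℕ → Set
IsO n p k o = OracleScheme n p k o × (∀ b → OracleScheme n p k b → o ≤ b)

-- Let H be a minimum (k−1)-fault-tolerant reachability subgraph of G for P.  By minimality every
-- edge e of H is essential: there are a demand (s , t) and at most k−1 faults F_e ⊆ H such that t is
-- reachable from s in H ∖ F_e but not in (H − e) ∖ F_e.  The relation "e′ ∈ F_e" has out-degree at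
-- most k−1, so repeatedly keeping an edge of in-degree at most k−1 and discarding its at most 2k−1
-- conflicts yields a set S of edges, none in another's fault set, with |H| ≤ (2k−1)|S|.
-- For A ⊆ S let G_A be the graph on 2n vertices consisting of a copy of H on the left vertices and a
-- detour u → v′ → v through a right vertex v′ for every (u , v) ∈ A.  Under the k faults F_e ∪ {e} the
-- query (s , t) is answered positively iff e ∈ A, since the detours of the other edges of A avoid F_e.
-- So the 2^|S| instances G_A get distinct oracle strings, which forces |S| ≤ 𝒪(2n,p,k).

module Submission where

open import Defs

open import Data.Bool using (Bool; true; false; _∧_; _∨_; not; if_then_else_)
open import Data.Bool.Properties
  using ( T-≡; ∧-conicalˡ; ∧-conicalʳ; ∨-conicalˡ; ∨-conicalʳ; ∨-zeroʳ; ∨-identityʳ; ∧-identityʳ; ∧-zeroʳ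
        ; not-injective; not-¬ )
  renaming (_≟_ to _≟ᵇ_)
open import Data.Empty using (⊥)
open import Data.Fin as Fin using (Fin; _↑ˡ_; _↑ʳ_; splitAt)
open import Data.Fin.Properties
  using (splitAt-↑ˡ; splitAt-↑ʳ; splitAt⁻¹-↑ˡ; splitAt⁻¹-↑ʳ; cast-involutive) renaming (_≟_ to _≟ᶠ_)
open import Data.List using (List; []; _∷_; _++_; map; length; filterᵇ; allFin; tabulate; cartesianProduct)
open import Data.List.Membership.Propositional using (_∈_; _∉_)
open import Data.List.Membership.Propositional.Properties
  using (∈-filter⁻; ∈-allFin; ∈-cartesianProduct⁺; ∈-++⁺ˡ; ∈-++⁺ʳ; ∈-++⁻; ∈-map⁺; ∈-map⁻)
open import Data.List.Properties
  using (map-++; map-∘; map-tabulate; tabulate-cong; length-++; length-map; ∷-injectiveʳ)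
  renaming (≡-dec to ≡-dec-List)
open import Data.List.Relation.Unary.All as All using (All; [])
open import Data.List.Relation.Unary.AllPairs using ([]; _∷_)
open import Data.List.Relation.Unary.Any using (here; there)
open import Data.List.Relation.Unary.Unique.Propositional using (Unique)
open import Data.List.Relation.Unary.Unique.Propositional.Properties
  using (filter⁺; allFin⁺; cartesianProduct⁺; ++⁺; map⁺)
open import Data.Nat using (ℕ; zero; suc; _+_; _*_; _^_; _∸_; _≟_; _≤_; _<_; _≤?_; z≤n; s≤s)
open import Data.Nat.Induction using (<-wellFounded)
open import Data.Nat.ListAction using (sum)
open import Data.Nat.ListAction.Properties using (sum-++)
open import Data.Nat.Properties
open import Data.Product using (Σ; Σ-syntax; ∃-syntax; _×_; _,_; proj₁; proj₂; uncurry)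
open import Data.Product.Properties using (≡-dec)
open import Data.Sum using (_⊎_; inj₁; inj₂; [_,_])
open import Function using (_∘_; id; Equivalence)
open import Induction.WellFounded using (Acc; acc)
open import Level using (0ℓ)
open import Relation.Binary.Definitions using (DecidableEquality)
open import Relation.Binary.PropositionalEquality hiding ([_])
open import Relation.Nullary using (¬_; Dec; yes; no; does; contradiction)
open import Relation.Nullary.Decidable
  using (T?; decidable-stable; dec-true; dec-false; map′; _×-dec_; _⊎-dec_)
open import Relation.Nullary.Negation using (¬¬-map; ¬¬-Monad)

open import Algebra.Properties.CommutativeSemigroup +-commutativeSemigroup
  using () renaming (interchange to +-interchange)

private variable
  A B : Set

-- Counting over lists

𝟙 : Bool → ℕ
𝟙 b = if b then 1 else 0

≢⇒opposite : ∀ {a b : Bool} → a ≢ b → a ≡ true × b ≡ false ⊎ a ≡ false × b ≡ true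
≢⇒opposite {true}  {false} _   = inj₁ (refl , refl)
≢⇒opposite {false} {true}  _   = inj₂ (refl , refl)
≢⇒opposite {true}  {true}  a≢b = contradiction refl a≢b
≢⇒opposite {false} {false} a≢b = contradiction refl a≢b

from-does : ∀ {P : Set} (P? : Dec P) → does P? ≡ true → P
from-does (yes p) _ = p

sumBy : (A → ℕ) → List A → ℕ
sumBy g xs = sum (map g xs)

count : (A → Bool) → List A → ℕ
count p = sumBy (𝟙 ∘ p)

sumBy-mono : ∀ {g h : A → ℕ} xs → (∀ {x} → x ∈ xs → g x ≤ h x) → sumBy g xs ≤ sumBy h xs
sumBy-mono []       g≤h = z≤n
sumBy-mono (x ∷ xs) g≤h = +-mono-≤ (g≤h (here refl)) (sumBy-mono xs (g≤h ∘ there))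

sumBy-+ : ∀ (g h : A → ℕ) xs → sumBy (λ x → g x + h x) xs ≡ sumBy g xs + sumBy h xs
sumBy-+ g h []       = refl
sumBy-+ g h (x ∷ xs) =
  trans (cong (g x + h x +_) (sumBy-+ g h xs)) (+-interchange (g x) (h x) _ _)

sumBy-const : ∀ c (xs : List A) → sumBy (λ _ → c) xs ≡ c * length xs
sumBy-const c []       = sym (*-zeroʳ c)
sumBy-const c (x ∷ xs) = trans (cong (c +_) (sumBy-const c xs)) (sym (*-suc c (length xs)))

sumBy-swap : ∀ (g : A → B → ℕ) xs ys →
  sumBy (λ x → sumBy (g x) ys) xs ≡ sumBy (λ y → sumBy (λ x → g x y) xs) ys
sumBy-swap g []       ys = sym (trans (sumBy-const 0 ys) (*-zeroˡ (length ys)))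
sumBy-swap g (x ∷ xs) ys =
  trans (cong (sumBy (g x) ys +_) (sumBy-swap g xs ys)) (sym (sumBy-+ (g x) _ ys))

sumBy-++ : ∀ (g : A → ℕ) xs ys → sumBy g (xs ++ ys) ≡ sumBy g xs + sumBy g ys
sumBy-++ g xs ys = trans (cong sum (map-++ g xs ys)) (sum-++ (map g xs) (map g ys))

sumBy-map : ∀ (g : B → ℕ) (f : A → B) xs → sumBy g (map f xs) ≡ sumBy (g ∘ f) xs
sumBy-map g f xs = cong sum (sym (map-∘ xs))

sumBy-cartesianProduct : ∀ (g : A × B → ℕ) xs ys →
  sumBy g (cartesianProduct xs ys) ≡ sumBy (λ x → sumBy (λ y → g (x , y)) ys) xs
sumBy-cartesianProduct g []       ys = refl
sumBy-cartesianProduct g (x ∷ xs) ys = trans (sumBy-++ g (map (x ,_) ys) _)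
  (cong₂ _+_ (sumBy-map g (x ,_) ys) (sumBy-cartesianProduct g xs ys))

sum-tabulate-↑ : ∀ m n (g : Fin (m + n) → ℕ) →
  sum (tabulate g) ≡ sum (tabulate (g ∘ (_↑ˡ n))) + sum (tabulate (g ∘ (m ↑ʳ_)))
sum-tabulate-↑ zero    n g = refl
sum-tabulate-↑ (suc m) n g =
  trans (cong (g Fin.zero +_) (sum-tabulate-↑ m n (g ∘ Fin.suc))) (sym (+-assoc (g Fin.zero) _ _))

sumBy-allFin : ∀ {n} (g : Fin n → ℕ) → sumBy g (allFin n) ≡ sum (tabulate g)
sumBy-allFin g = cong sum (map-tabulate id g)

sum-tabulate-zero : ∀ {n} (g : Fin n → ℕ) → (∀ i → g i ≡ 0) → sum (tabulate g) ≡ 0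
sum-tabulate-zero {zero}  g g≡0 = refl
sum-tabulate-zero {suc n} g g≡0 rewrite g≡0 Fin.zero = sum-tabulate-zero (g ∘ Fin.suc) (g≡0 ∘ Fin.suc)

∃≤-average : ∀ (g : A → ℕ) d xs → 0 < length xs → sumBy g xs ≤ d * length xs →
  ∃[ x ] x ∈ xs × g x ≤ d
∃≤-average g d (x ∷ xs) _ total with g x ≤? d
... | yes gx≤d = x , here refl , gx≤d
... | no gx≰d with xs
...   | [] = contradiction (m+n≤o⇒m≤o (g x) (≤-trans total (≤-reflexive (*-identityʳ d)))) gx≰d
...   | y ∷ ys =
  let z , z∈ , gz≤d = ∃≤-average g d (y ∷ ys) (s≤s z≤n) rest in z , there z∈ , gz≤d
  where
    rest : sumBy g (y ∷ ys) ≤ d * length (y ∷ ys)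
    rest = +-cancelˡ-≤ d _ _ (≤-trans (+-monoˡ-≤ _ (<⇒≤ (≰⇒> gx≰d)))
                                      (≤-trans total (≤-reflexive (*-suc d _))))

module _ (p : A → Bool) where

  length-filterᵇ : ∀ xs → length (filterᵇ p xs) ≡ count p xs
  length-filterᵇ []       = refl
  length-filterᵇ (x ∷ xs) with p x
  ... | true  = cong suc (length-filterᵇ xs)
  ... | false = length-filterᵇ xs

  count-filterᵇ-≤ : ∀ (q : A → Bool) xs → count q (filterᵇ p xs) ≤ count q xs
  count-filterᵇ-≤ q []       = z≤n
  count-filterᵇ-≤ q (x ∷ xs) with p x
  ... | true  = +-monoʳ-≤ (𝟙 (q x)) (count-filterᵇ-≤ q xs)
  ... | false = ≤-trans (count-filterᵇ-≤ q xs) (m≤n+m _ _)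

  ∈-filterᵇ⁻ : ∀ {y} xs → y ∈ filterᵇ p xs → y ∈ xs × p y ≡ true
  ∈-filterᵇ⁻ xs y∈ = let y∈xs , py = ∈-filter⁻ (T? ∘ p) {xs = xs} y∈ in y∈xs , Equivalence.to T-≡ py

  filterᵇ-unique : ∀ {xs} → Unique xs → Unique (filterᵇ p xs)
  filterᵇ-unique = filter⁺ (T? ∘ p)

  count-partition : ∀ xs → count (not ∘ p) xs + count p xs ≡ length xs
  count-partition []       = refl
  count-partition (x ∷ xs) with p x
  ... | true  = trans (+-suc _ _) (cong suc (count-partition xs))
  ... | false = cong suc (count-partition xs)

  count-≡0 : ∀ xs → (∀ {x} → x ∈ xs → p x ≡ false) → count p xs ≡ 0
  count-≡0 []       _     = refl
  count-≡0 (x ∷ xs) px≡false rewrite px≡false (here refl) = count-≡0 xs (px≡false ∘ there)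

  count-≤1 : ∀ xs → Unique xs → (∀ {x y} → x ∈ xs → y ∈ xs → p x ≡ true → p y ≡ true → x ≡ y) →
    count p xs ≤ 1
  count-≤1 []       _          _    = z≤n
  count-≤1 (x ∷ xs) (x∉ ∷ uxs) once with p x in px
  ... | false = count-≤1 xs uxs (λ y∈ z∈ → once (there y∈) (there z∈))
  ... | true  = ≤-reflexive (cong suc (count-≡0 xs others))
    where
      others : ∀ {y} → y ∈ xs → p y ≡ false
      others {y} y∈ with p y in py
      ... | false = refl
      ... | true  = contradiction (once (here refl) (there y∈) px py) (All.lookup x∉ y∈)

module _ {p q : A → Bool} (p⇒q : ∀ x → p x ≡ true → q x ≡ true) where

  𝟙-mono : ∀ x → 𝟙 (p x) ≤ 𝟙 (q x)
  𝟙-mono x with p x in px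
  ... | false = z≤n
  ... | true  rewrite p⇒q x px = ≤-refl

  count-mono : ∀ xs → count p xs ≤ count q xs
  count-mono xs = sumBy-mono xs (λ {x} _ → 𝟙-mono x)

  count-mono-< : ∀ xs {y} → y ∈ xs → p y ≡ false → q y ≡ true → count p xs < count q xs
  count-mono-< (x ∷ xs) (here refl) py qy rewrite py | qy = s≤s (count-mono xs)
  count-mono-< (x ∷ xs) (there y∈)  py qy = +-mono-≤-< (𝟙-mono x) (count-mono-< xs y∈ py qy)

count-∨ : ∀ (p q : A → Bool) xs → count (λ x → p x ∨ q x) xs ≤ count p xs + count q xs
count-∨ p q xs = ≤-trans (sumBy-mono xs (λ {x} _ → 𝟙-∨ (p x) (q x))) (≤-reflexive (sumBy-+ _ _ xs))
  where
    𝟙-∨ : ∀ a b → 𝟙 (a ∨ b) ≤ 𝟙 a + 𝟙 b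
    𝟙-∨ false b = ≤-refl
    𝟙-∨ true  b = s≤s z≤n

length≡sumBy-1 : ∀ (xs : List A) → length xs ≡ sumBy (λ _ → 1) xs
length≡sumBy-1 xs = sym (trans (sumBy-const 1 xs) (*-identityˡ (length xs)))

count-∈ : ∀ (p : A → Bool) {y} xs → y ∈ xs → p y ≡ true → 1 ≤ count p xs
count-∈ p (x ∷ xs) (here refl) py rewrite py = s≤s z≤n
count-∈ p (x ∷ xs) (there y∈)  py = ≤-trans (count-∈ p xs y∈ py) (m≤n+m _ _)

length-≤-injection : DecidableEquality B → ∀ (f : A → B) xs ys → Unique xs →
  (∀ {x x′} → x ∈ xs → x′ ∈ xs → f x ≡ f x′ → x ≡ x′) → (∀ {x} → x ∈ xs → f x ∈ ys) →
  length xs ≤ length ys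
length-≤-injection _≟_ f xs ys uxs inj into = begin
  length xs
    ≡⟨ length≡sumBy-1 xs ⟩
  sumBy (λ _ → 1) xs
    ≤⟨ sumBy-mono xs (λ {x} x∈ → count-∈ _ ys (into x∈) (dec-true (f x ≟ f x) refl)) ⟩
  sumBy (λ x → count (λ y → does (f x ≟ y)) ys) xs
    ≡⟨ sumBy-swap (λ x y → 𝟙 (does (f x ≟ y))) xs ys ⟩
  sumBy (λ y → count (λ x → does (f x ≟ y)) xs) ys
    ≤⟨ sumBy-mono ys (λ {y} _ → count-≤1 _ xs uxs (preimage-unique y)) ⟩
  sumBy (λ _ → 1) ys
    ≡⟨ length≡sumBy-1 ys ⟨
  length ys ∎
  where
    open ≤-Reasoning
    preimage-unique : ∀ y {x x′} → x ∈ xs → x′ ∈ xs → does (f x ≟ y) ≡ true → does (f x′ ≟ y) ≡ true → x ≡ x′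
    preimage-unique y {x} {x′} x∈ x′∈ fx≡y fx′≡y =
      inj x∈ x′∈ (trans (from-does (f x ≟ y) fx≡y) (sym (from-does (f x′ ≟ y) fx′≡y)))

-- Independent sets of sparse relations

module IndependentSet {A : Set} (_≟_ : DecidableEquality A) (bad : A → A → Bool) (d : ℕ) where

  record IndependentSubset (L : List A) : Set where
    field
      members     : List A
      unique      : Unique members
      ⊆L          : ∀ {x} → x ∈ members → x ∈ L
      independent : ∀ {x y} → x ∈ members → y ∈ members → x ≢ y → bad x y ≡ false
      large       : length L ≤ suc (d + d) * length members

  conflict : A → A → Bool
  conflict x z = bad x z ∨ (bad z x ∨ does (z ≟ x))

  no-conflict : ∀ {x z} → conflict x z ≡ false → bad x z ≡ false × bad z x ≡ false × z ≢ x
  no-conflict {x} {z} ok =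
    let rest = ∨-conicalʳ (bad x z) _ ok
    in ∨-conicalˡ (bad x z) _ ok , ∨-conicalˡ (bad z x) _ rest ,
       λ z≡x → contradiction (∨-conicalʳ (bad z x) _ rest) (not-¬ (dec-true (z ≟ x) z≡x))

  low-in-degree : ∀ L → 0 < length L → (∀ x → count (bad x) L ≤ d) →
    ∃[ x ] x ∈ L × count (λ z → bad z x) L ≤ d
  low-in-degree L nonempty outdeg = ∃≤-average (λ x → count (λ z → bad z x) L) d L nonempty (begin
    sumBy (λ x → count (λ z → bad z x) L) L ≡⟨ sumBy-swap (λ x z → 𝟙 (bad z x)) L L ⟩
    sumBy (λ z → count (bad z) L) L         ≤⟨ sumBy-mono L (λ {z} _ → outdeg z) ⟩
    sumBy (λ _ → d) L                       ≡⟨ sumBy-const d L ⟩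
    d * length L                            ∎)
    where open ≤-Reasoning

  count-conflict : ∀ L x → Unique L → count (bad x) L ≤ d → count (λ z → bad z x) L ≤ d →
    count (conflict x) L ≤ suc (d + d)
  count-conflict L x uL out in′ = begin
    count (conflict x) L
      ≤⟨ count-∨ (bad x) _ L ⟩
    count (bad x) L + count (λ z → bad z x ∨ does (z ≟ x)) L
      ≤⟨ +-monoʳ-≤ _ (count-∨ _ _ L) ⟩
    count (bad x) L + (count (λ z → bad z x) L + count (λ z → does (z ≟ x)) L)
      ≤⟨ +-mono-≤ out (+-mono-≤ in′ (count-≤1 _ L uL at-most-x)) ⟩
    d + (d + 1)
      ≡⟨ cong (d +_) (+-comm d 1) ⟩
    d + suc d
      ≡⟨ +-suc d d ⟩
    suc (d + d) ∎
    where
      open ≤-Reasoning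
      at-most-x : ∀ {y z} → y ∈ L → z ∈ L → does (y ≟ x) ≡ true → does (z ≟ x) ≡ true → y ≡ z
      at-most-x {y} {z} _ _ y≡x z≡x = trans (from-does (y ≟ x) y≡x) (sym (from-does (z ≟ x) z≡x))

  self-conflict : ∀ x → conflict x x ≡ true
  self-conflict x rewrite dec-true (x ≟ x) refl | ∨-zeroʳ (bad x x) = ∨-zeroʳ (bad x x)

  nonconflicting-shorter : ∀ L {x} → x ∈ L → length (filterᵇ (not ∘ conflict x) L) < length L
  nonconflicting-shorter L {x} x∈L = begin-strict
    length (filterᵇ (not ∘ conflict x) L)              ≡⟨ length-filterᵇ (not ∘ conflict x) L ⟩
    count (not ∘ conflict x) L                         <⟨ m<m+n _ (count-∈ _ L x∈L (self-conflict x)) ⟩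
    count (not ∘ conflict x) L + count (conflict x) L  ≡⟨ count-partition (conflict x) L ⟩
    length L                                           ∎
    where open ≤-Reasoning

  extend : ∀ {L x} → x ∈ L → count (conflict x) L ≤ suc (d + d) →
    IndependentSubset (filterᵇ (not ∘ conflict x) L) → IndependentSubset L
  extend {L} {x} x∈L few S′ = record
    { members     = x ∷ members
    ; unique      = All.tabulate (λ z∈ → (λ x≡z → proj₂ (proj₂ (kept z∈)) (sym x≡z))) ∷ unique
    ; ⊆L          = λ { (here refl) → x∈L ; (there z∈) → proj₁ (∈-filterᵇ⁻ (not ∘ conflict x) L (⊆L z∈)) }
    ; independent = independent′
    ; large       = large′
    }
    where
      open IndependentSubset S′
      kept : ∀ {z} → z ∈ members → bad x z ≡ false × bad z x ≡ false × z ≢ x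
      kept z∈ = no-conflict (not-injective (proj₂ (∈-filterᵇ⁻ (not ∘ conflict x) L (⊆L z∈))))
      independent′ : ∀ {y z} → y ∈ x ∷ members → z ∈ x ∷ members → y ≢ z → bad y z ≡ false
      independent′ (here refl) (here refl) y≢z = contradiction refl y≢z
      independent′ (here refl) (there z∈)  _   = proj₁ (kept z∈)
      independent′ (there y∈)  (here refl) _   = proj₁ (proj₂ (kept y∈))
      independent′ (there y∈)  (there z∈)  y≢z = independent y∈ z∈ y≢z
      large′ : length L ≤ suc (d + d) * length (x ∷ members)
      large′ = begin
        length L
          ≡⟨ count-partition (conflict x) L ⟨
        count (not ∘ conflict x) L + count (conflict x) L
          ≡⟨ cong (_+ count (conflict x) L) (length-filterᵇ (not ∘ conflict x) L) ⟨
        length (filterᵇ (not ∘ conflict x) L) + count (conflict x) L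
          ≤⟨ +-mono-≤ large few ⟩
        suc (d + d) * length members + suc (d + d)
          ≡⟨ +-comm _ (suc (d + d)) ⟩
        suc (d + d) + suc (d + d) * length members
          ≡⟨ *-suc (suc (d + d)) (length members) ⟨
        suc (d + d) * length (x ∷ members) ∎
        where open ≤-Reasoning

  independentSubset : ∀ L → Unique L → (∀ x → count (bad x) L ≤ d) → IndependentSubset L
  independentSubset L = go L (<-wellFounded (length L))
    where
      go : ∀ L → Acc _<_ (length L) → Unique L → (∀ x → count (bad x) L ≤ d) → IndependentSubset L
      go [] _ _ _ = record
        { members = [] ; unique = [] ; ⊆L = λ () ; independent = λ () ; large = z≤n }
      go L@(_ ∷ _) (acc smaller) uL outdeg with low-in-degree L (s≤s z≤n) outdeg
      ... | x , x∈L , indeg =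
        extend x∈L (count-conflict L x uL (outdeg x) indeg)
          (go (filterᵇ (not ∘ conflict x) L) (smaller (nonconflicting-shorter L x∈L))
              (filterᵇ-unique (not ∘ conflict x) uL)
              (λ z → ≤-trans (count-filterᵇ-≤ (not ∘ conflict x) (bad z) L) (outdeg z)))

-- Edge sets and reachability

Edge : ℕ → Set
Edge n = Fin n × Fin n

allEdges : ∀ n → List (Edge n)
allEdges n = cartesianProduct (allFin n) (allFin n)

∈-allEdges : ∀ {n} (e : Edge n) → e ∈ allEdges n
∈-allEdges (u , v) = ∈-cartesianProduct⁺ (∈-allFin u) (∈-allFin v)

allEdges-unique : ∀ n → Unique (allEdges n)
allEdges-unique n = cartesianProduct⁺ (allFin⁺ n) (allFin⁺ n)

module _ {n : ℕ} where

  _≟ₑ_ : DecidableEquality (Edge n)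
  _≟ₑ_ = ≡-dec _≟ᶠ_ _≟ᶠ_

  ｛_｝ₑ : Edge n → EdgeSet n
  ｛ e ｝ₑ u v = does ((u , v) ≟ₑ e)

  _∪ₑ_ : EdgeSet n → EdgeSet n → EdgeSet n
  (X ∪ₑ Y) u v = X u v ∨ Y u v

  _∩ₑ_ : EdgeSet n → EdgeSet n → EdgeSet n
  (X ∩ₑ Y) u v = X u v ∧ Y u v

  _-ₑ_ : EdgeSet n → Edge n → EdgeSet n
  E -ₑ e = E ∖ₑ ｛ e ｝ₑ

  ∅ₑ : EdgeSet n
  ∅ₑ _ _ = false

  ∪ₑ-⊆ : ∀ {X Y Z : EdgeSet n} → X ⊆ₑ Z → Y ⊆ₑ Z → (X ∪ₑ Y) ⊆ₑ Z
  ∪ₑ-⊆ {X} X⊆Z Y⊆Z u v uv∈ with X u v in Xuv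
  ... | true  = X⊆Z u v Xuv
  ... | false = Y⊆Z u v uv∈

  ｛｝ₑ-⊆ : ∀ {Z : EdgeSet n} {e} → uncurry Z e ≡ true → ｛ e ｝ₑ ⊆ₑ Z
  ｛｝ₑ-⊆ {e = e} Ze u v uv∈ with from-does ((u , v) ≟ₑ e) uv∈
  ... | refl = Ze

  ∖ₑ-∈⁻ : ∀ (E F : EdgeSet n) {u v} → (E ∖ₑ F) u v ≡ true → E u v ≡ true × F u v ≡ false
  ∖ₑ-∈⁻ E F {u} {v} uv∈ = ∧-conicalˡ (E u v) _ uv∈ , not-injective (∧-conicalʳ (E u v) _ uv∈)

  ∖ₑ-∈⁺ : ∀ (E F : EdgeSet n) {u v} → E u v ≡ true → F u v ≡ false → (E ∖ₑ F) u v ≡ true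
  ∖ₑ-∈⁺ E F Euv Fuv rewrite Euv | Fuv = refl

  ⊆ₑ-∉ : ∀ {X Y : EdgeSet n} → X ⊆ₑ Y → ∀ {u v} → Y u v ≡ false → X u v ≡ false
  ⊆ₑ-∉ {X} X⊆Y {u} {v} Yuv with X u v in Xuv
  ... | false = refl
  ... | true  = trans (sym (X⊆Y u v Xuv)) Yuv

  ∖ₑ-⊆ : ∀ (E F : EdgeSet n) → (E ∖ₑ F) ⊆ₑ E
  ∖ₑ-⊆ E F u v = proj₁ ∘ ∖ₑ-∈⁻ E F

  ∖ₑ-monoˡ : ∀ {E E′ : EdgeSet n} F → E ⊆ₑ E′ → (E ∖ₑ F) ⊆ₑ (E′ ∖ₑ F)
  ∖ₑ-monoˡ {E} {E′} F E⊆E′ u v uv∈ =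
    let Euv , Fuv = ∖ₑ-∈⁻ E F uv∈ in ∖ₑ-∈⁺ E′ F (E⊆E′ u v Euv) Fuv

  ∖ₑ-antitoneʳ : ∀ E {F F′ : EdgeSet n} → F′ ⊆ₑ F → (E ∖ₑ F) ⊆ₑ (E ∖ₑ F′)
  ∖ₑ-antitoneʳ E {F} {F′} F′⊆F u v uv∈ =
    let Euv , Fuv = ∖ₑ-∈⁻ E F uv∈ in ∖ₑ-∈⁺ E F′ Euv (⊆ₑ-∉ F′⊆F Fuv)

  ∖ₑ-∩ₑ : ∀ {E H : EdgeSet n} F → E ⊆ₑ H → (E ∖ₑ (F ∩ₑ H)) ⊆ₑ (E ∖ₑ F)
  ∖ₑ-∩ₑ {E} {H} F E⊆H u v uv∈ with E u v in Euv
  ... | true rewrite E⊆H u v Euv | ∧-identityʳ (F u v) = uv∈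

  -ₑ-keeps : ∀ E {e u v} → E u v ≡ true → (u , v) ≢ e → (E -ₑ e) u v ≡ true
  -ₑ-keeps E {e} {u} {v} uv∈ uv≢e = ∖ₑ-∈⁺ E ｛ e ｝ₑ uv∈ (dec-false ((u , v) ≟ₑ e) uv≢e)

  -ₑ-removes : ∀ E {e u v} → (E -ₑ e) u v ≡ true → (u , v) ≢ e
  -ₑ-removes E {e} {u} {v} uv∈ uv≡e =
    contradiction (proj₂ (∖ₑ-∈⁻ E ｛ e ｝ₑ uv∈)) (not-¬ (dec-true ((u , v) ≟ₑ e) uv≡e))

  Reach-++ : ∀ {E : EdgeSet n} {a b c} → Reach E a b → Reach E b c → Reach E a c
  Reach-++ here       q = q
  Reach-++ (step e p) q = step e (Reach-++ p q)

  Reach-mono : ∀ {E E′ : EdgeSet n} → E ⊆ₑ E′ → ∀ {s t} → Reach E s t → Reach E′ s t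
  Reach-mono E⊆E′ here       = here
  Reach-mono E⊆E′ (step e p) = step (E⊆E′ _ _ e) (Reach-mono E⊆E′ p)

  Reach-split : ∀ E u v {s t} → Reach E s t →
    Reach (E -ₑ (u , v)) s t ⊎ (E u v ≡ true × Reach (E -ₑ (u , v)) s u × Reach (E -ₑ (u , v)) v t)
  Reach-split E u v here = inj₁ here
  Reach-split E u v (step {s} {w} e p) with (s , w) ≟ₑ (u , v)
  ... | yes refl = inj₂ (e , here , [ id , proj₂ ∘ proj₂ ] (Reach-split E u v p))
  ... | no  sw≢uv with Reach-split E u v p
  ...   | inj₁ p′              = inj₁ (step (-ₑ-keeps E e sw≢uv) p′)
  ...   | inj₂ (uv∈ , p₁ , p₂) = inj₂ (uv∈ , step (-ₑ-keeps E e sw≢uv) p₁ , p₂)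

  Reach-join : ∀ E u v {s t} →
    Reach (E -ₑ (u , v)) s t ⊎ (E u v ≡ true × Reach (E -ₑ (u , v)) s u × Reach (E -ₑ (u , v)) v t) →
    Reach E s t
  Reach-join E u v (inj₁ p)              = Reach-mono (∖ₑ-⊆ E ｛ u , v ｝ₑ) p
  Reach-join E u v (inj₂ (uv∈ , p₁ , p₂)) =
    Reach-++ (Reach-mono (∖ₑ-⊆ E ｛ u , v ｝ₑ) p₁) (step uv∈ (Reach-mono (∖ₑ-⊆ E ｛ u , v ｝ₑ) p₂))

  Reach-dec′ : ∀ (l : List (Edge n)) E → (∀ u v → E u v ≡ true → (u , v) ∈ l) →
    ∀ s t → Dec (Reach E s t)
  Reach-dec′ [] E covered s t = map′ (λ { refl → here }) from-path (s ≟ᶠ t)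
    where
      from-path : Reach E s t → s ≡ t
      from-path here               = refl
      from-path (step {u = u} e _) with covered s u e
      ... | ()
  Reach-dec′ ((u , v) ∷ l) E covered s t =
    map′ (Reach-join E u v) (Reach-split E u v)
      (rec s t ⊎-dec ((E u v ≟ᵇ true) ×-dec (rec s u ×-dec rec v t)))
    where
      covered′ : ∀ a b → (E -ₑ (u , v)) a b ≡ true → (a , b) ∈ l
      covered′ a b ab∈ with covered a b (∖ₑ-⊆ E ｛ u , v ｝ₑ a b ab∈)
      ... | here ab≡uv = contradiction ab≡uv (-ₑ-removes E ab∈)
      ... | there ab∈l = ab∈l
      rec : ∀ a b → Dec (Reach (E -ₑ (u , v)) a b)
      rec = Reach-dec′ l (E -ₑ (u , v)) covered′

  Reach-dec : ∀ E s t → Dec (Reach E s t)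
  Reach-dec E = Reach-dec′ (allEdges n) E (λ u v _ → ∈-allEdges (u , v))

Reach-map : ∀ {m n} {E : EdgeSet m} {E′ : EdgeSet n} (f : Fin m → Fin n) →
  (∀ a b → E a b ≡ true → E′ (f a) (f b) ≡ true ⊎ f a ≡ f b) →
  ∀ {s t} → Reach E s t → Reach E′ (f s) (f t)
Reach-map f hom here = here
Reach-map f hom (step {s} {u} e p) with hom s u e
... | inj₁ e′   = step e′ (Reach-map f hom p)
... | inj₂ s≡u rewrite s≡u = Reach-map f hom p

module _ {n : ℕ} where

  ∣∣ₑ≡count : ∀ (X : EdgeSet n) → ∣ X ∣ₑ ≡ count (uncurry X) (allEdges n)
  ∣∣ₑ≡count X = sym (sumBy-cartesianProduct (𝟙 ∘ uncurry X) (allFin n) (allFin n))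

  ∣∣ₑ≡sum-tabulate : ∀ (X : EdgeSet n) → ∣ X ∣ₑ ≡ sum (tabulate λ u → sum (tabulate λ v → 𝟙 (X u v)))
  ∣∣ₑ≡sum-tabulate X = trans (sumBy-allFin (λ u → sumBy (𝟙 ∘ X u) (allFin n)))
                              (cong sum (tabulate-cong (λ u → sumBy-allFin (𝟙 ∘ X u))))

  ∣∅ₑ∣ₑ : ∣ ∅ₑ {n} ∣ₑ ≡ 0
  ∣∅ₑ∣ₑ = trans (∣∣ₑ≡count ∅ₑ) (count-≡0 (uncurry ∅ₑ) (allEdges n) (λ _ → refl))

  edgeList : EdgeSet n → List (Edge n)
  edgeList X = filterᵇ (uncurry X) (allEdges n)

  length-edgeList : ∀ X → length (edgeList X) ≡ ∣ X ∣ₑ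
  length-edgeList X = trans (length-filterᵇ (uncurry X) (allEdges n)) (sym (∣∣ₑ≡count X))

  edgeList-unique : ∀ X → Unique (edgeList X)
  edgeList-unique X = filterᵇ-unique (uncurry X) (allEdges-unique n)

  ∈-edgeList⁻ : ∀ X {e} → e ∈ edgeList X → uncurry X e ≡ true
  ∈-edgeList⁻ X = proj₂ ∘ ∈-filterᵇ⁻ (uncurry X) (allEdges n)

  count-edgeList≤∣∣ₑ : ∀ X Y → count (uncurry X) (edgeList Y) ≤ ∣ X ∣ₑ
  count-edgeList≤∣∣ₑ X Y =
    ≤-trans (count-filterᵇ-≤ (uncurry Y) (uncurry X) (allEdges n)) (≤-reflexive (sym (∣∣ₑ≡count X)))

  ∣∣ₑ-mono : ∀ {X Y : EdgeSet n} → X ⊆ₑ Y → ∣ X ∣ₑ ≤ ∣ Y ∣ₑ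
  ∣∣ₑ-mono {X} {Y} X⊆Y = subst₂ _≤_ (sym (∣∣ₑ≡count X)) (sym (∣∣ₑ≡count Y))
    (count-mono (λ e → X⊆Y (proj₁ e) (proj₂ e)) (allEdges n))

  ∣-ₑ∣< : ∀ H {u v} → H u v ≡ true → ∣ H -ₑ (u , v) ∣ₑ < ∣ H ∣ₑ
  ∣-ₑ∣< H {u} {v} uv∈ = subst₂ _<_ (sym (∣∣ₑ≡count (H -ₑ (u , v)))) (sym (∣∣ₑ≡count H))
    (count-mono-< (λ e → ∖ₑ-⊆ H ｛ u , v ｝ₑ (proj₁ e) (proj₂ e)) (allEdges n) (∈-allEdges (u , v)) removed uv∈)
    where
      removed : (H -ₑ (u , v)) u v ≡ false
      removed rewrite uv∈ | dec-true ((u , v) ≟ₑ (u , v)) refl = refl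

  ∣∪ₑ｛｝ₑ∣≤ : ∀ X e → ∣ X ∪ₑ ｛ e ｝ₑ ∣ₑ ≤ suc ∣ X ∣ₑ
  ∣∪ₑ｛｝ₑ∣≤ X e = begin
    ∣ X ∪ₑ ｛ e ｝ₑ ∣ₑ
      ≡⟨ ∣∣ₑ≡count (X ∪ₑ ｛ e ｝ₑ) ⟩
    count (uncurry (X ∪ₑ ｛ e ｝ₑ)) (allEdges n)
      ≤⟨ count-∨ (uncurry X) (uncurry ｛ e ｝ₑ) (allEdges n) ⟩
    count (uncurry X) (allEdges n) + count (uncurry ｛ e ｝ₑ) (allEdges n)
      ≤⟨ +-monoʳ-≤ _ (count-≤1 _ (allEdges n) (allEdges-unique n) only-e) ⟩
    count (uncurry X) (allEdges n) + 1
      ≡⟨ cong (_+ 1) (∣∣ₑ≡count X) ⟨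
    ∣ X ∣ₑ + 1
      ≡⟨ +-comm ∣ X ∣ₑ 1 ⟩
    suc ∣ X ∣ₑ ∎
    where
      open ≤-Reasoning
      only-e : ∀ {a b} → a ∈ allEdges n → b ∈ allEdges n →
        uncurry ｛ e ｝ₑ a ≡ true → uncurry ｛ e ｝ₑ b ≡ true → a ≡ b
      only-e {a} {b} _ _ a≡e b≡e = trans (from-does (a ≟ₑ e) a≡e) (sym (from-does (b ≟ₑ e) b≡e))

-- Essential edges of minimum fault-tolerant subgraphs

-- The faults lie inside H, so that they are also faults of the doubled graphs built from H.
record Essential {n} (k : ℕ) (P H : EdgeSet n) (e : Edge n) : Set where
  field
    source target : Fin n
    faults        : EdgeSet n
    faults⊆H      : faults ⊆ₑ H
    few-faults    : ∣ faults ∣ₑ ≤ k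
    demanded      : P source target ≡ true
    survives      : Reach (H ∖ₑ faults) source target
    cut           : ¬ Reach ((H -ₑ e) ∖ₑ faults) source target

module _ {n k} {G P H : EdgeSet n} (H-ftrs : IsFTRS k G P H) where

  ¬Essential⇒IsFTRS : ∀ e → ¬ Essential k P H e → IsFTRS k G P (H -ₑ e)
  ¬Essential⇒IsFTRS e inessential =
    H-e⊆G , λ s t Pst F F⊆G few → preserved s t Pst F F⊆G few , Reach-mono (∖ₑ-monoˡ F H-e⊆G)
    where
      H-e⊆G : (H -ₑ e) ⊆ₑ G
      H-e⊆G u v = proj₁ H-ftrs u v ∘ ∖ₑ-⊆ H ｛ e ｝ₑ u v

      preserved : ∀ s t → P s t ≡ true → ∀ F → F ⊆ₑ G → ∣ F ∣ₑ ≤ k →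
        Reach (G ∖ₑ F) s t → Reach ((H -ₑ e) ∖ₑ F) s t
      preserved s t Pst F F⊆G few p with Reach-dec ((H -ₑ e) ∖ₑ F) s t
      ... | yes p′ = p′
      ... | no  ¬p′ = contradiction witness inessential
        where
          witness : Essential k P H e
          witness = record
            { source     = s
            ; target     = t
            ; faults     = F ∩ₑ H
            ; faults⊆H   = λ u v → ∧-conicalʳ (F u v) _
            ; few-faults = ≤-trans (∣∣ₑ-mono (λ u v → ∧-conicalˡ (F u v) _)) few
            ; demanded   = Pst
            ; survives   = Reach-mono (∖ₑ-antitoneʳ H (λ u v → ∧-conicalˡ (F u v) _))
                                      (proj₁ (proj₂ H-ftrs s t Pst F F⊆G few) p)
            ; cut        = ¬p′ ∘ Reach-mono (∖ₑ-∩ₑ F (∖ₑ-⊆ H ｛ e ｝ₑ))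
            }

  minimum⇒essential : (∀ H′ → IsFTRS k G P H′ → ∣ H ∣ₑ ≤ ∣ H′ ∣ₑ) →
    ∀ {u v} → H u v ≡ true → ¬ ¬ Essential k P H (u , v)
  minimum⇒essential minimum uv∈ inessential =
    <⇒≱ (∣-ₑ∣< H uv∈) (minimum _ (¬Essential⇒IsFTRS _ inessential))

-- The doubled graphs

module Doubling (n : ℕ) where

  -- 2 * n unfolds to n + (n + 0): the right copy is indexed by Fin (n + 0), hence the casts.
  private
    toFin : Fin (n + 0) → Fin n
    toFin = Fin.cast (+-identityʳ n)

    fromFin : Fin n → Fin (n + 0)
    fromFin = Fin.cast (sym (+-identityʳ n))

  left : Fin n → Fin (2 * n)
  left u = u ↑ˡ (n + 0)

  mid : Fin n → Fin (2 * n)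
  mid v = n ↑ʳ fromFin v

  data Side : Fin (2 * n) → Set where
    is-left : ∀ u → Side (left u)
    is-mid  : ∀ v → Side (mid v)

  side : ∀ a → Side a
  side a with splitAt n a in eq
  ... | inj₁ u = subst Side (splitAt⁻¹-↑ˡ eq) (is-left u)
  ... | inj₂ j = subst Side (trans (cong (n ↑ʳ_) fromFin-toFin) (splitAt⁻¹-↑ʳ eq)) (is-mid (toFin j))
    where
      fromFin-toFin : fromFin (toFin j) ≡ j
      fromFin-toFin = cast-involutive (sym (+-identityʳ n)) (+-identityʳ n) j

  collapse : Fin (2 * n) → Fin n
  collapse a = [ id , toFin ] (splitAt n a)

  leftCopy : EdgeSet n → EdgeSet (2 * n)
  leftCopy X a b = arcs (splitAt n a) (splitAt n b)
    where
      arcs : Fin n ⊎ Fin (n + 0) → Fin n ⊎ Fin (n + 0) → Bool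
      arcs (inj₁ u) (inj₁ v) = X u v
      arcs _        _        = false

  -- H on the left copy, and a detour left u → mid v → left v for every edge (u , v) of D.
  detour : EdgeSet n → EdgeSet n → EdgeSet (2 * n)
  detour H D a b = arcs (splitAt n a) (splitAt n b)
    where
      arcs : Fin n ⊎ Fin (n + 0) → Fin n ⊎ Fin (n + 0) → Bool
      arcs (inj₁ u) (inj₁ v) = H u v
      arcs (inj₁ u) (inj₂ j) = D u (toFin j)
      arcs (inj₂ j) (inj₁ w) = does (toFin j ≟ᶠ w)
      arcs (inj₂ _) (inj₂ _) = false

  private
    split-↑ˡ : ∀ u → splitAt n (left u) ≡ inj₁ u
    split-↑ˡ u = splitAt-↑ˡ n u (n + 0)

    split-↑ʳ : ∀ j → splitAt n (n ↑ʳ j) ≡ inj₂ j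
    split-↑ʳ = splitAt-↑ʳ n (n + 0)

    toFin-fromFin : ∀ v → toFin (fromFin v) ≡ v
    toFin-fromFin = cast-involutive (+-identityʳ n) (sym (+-identityʳ n))

  collapse-left : ∀ u → collapse (left u) ≡ u
  collapse-left u rewrite split-↑ˡ u = refl

  collapse-mid : ∀ v → collapse (mid v) ≡ v
  collapse-mid v rewrite split-↑ʳ (fromFin v) = toFin-fromFin v

  leftCopy-left-left : ∀ X u v → leftCopy X (left u) (left v) ≡ X u v
  leftCopy-left-left X u v rewrite split-↑ˡ u | split-↑ˡ v = refl

  leftCopy-↑ʳ-target : ∀ X a j → leftCopy X a (n ↑ʳ j) ≡ false
  leftCopy-↑ʳ-target X a j rewrite split-↑ʳ j with splitAt n a
  ... | inj₁ _ = refl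
  ... | inj₂ _ = refl

  leftCopy-↑ʳ-source : ∀ X j b → leftCopy X (n ↑ʳ j) b ≡ false
  leftCopy-↑ʳ-source X j b rewrite split-↑ʳ j = refl

  detour-left-left : ∀ H D u v → detour H D (left u) (left v) ≡ H u v
  detour-left-left H D u v rewrite split-↑ˡ u | split-↑ˡ v = refl

  detour-left-mid : ∀ H D u v → detour H D (left u) (mid v) ≡ D u v
  detour-left-mid H D u v rewrite split-↑ˡ u | split-↑ʳ (fromFin v) | toFin-fromFin v = refl

  detour-mid-left : ∀ H D v w → detour H D (mid v) (left w) ≡ does (v ≟ᶠ w)
  detour-mid-left H D v w rewrite split-↑ˡ w | split-↑ʳ (fromFin v) | toFin-fromFin v = refl

  detour-mid-mid : ∀ H D v w → detour H D (mid v) (mid w) ≡ false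
  detour-mid-mid H D v w rewrite split-↑ʳ (fromFin v) | split-↑ʳ (fromFin w) = refl

  ∣leftCopy∣ₑ : ∀ X → ∣ leftCopy X ∣ₑ ≡ ∣ X ∣ₑ
  ∣leftCopy∣ₑ X = begin
    ∣ leftCopy X ∣ₑ
      ≡⟨ ∣∣ₑ≡sum-tabulate (leftCopy X) ⟩
    sum (tabulate row)
      ≡⟨ sum-tabulate-↑ n (n + 0) row ⟩
    sum (tabulate (row ∘ left)) + sum (tabulate λ j → row (n ↑ʳ j))
      ≡⟨ cong₂ _+_ (cong sum (tabulate-cong left-row)) (sum-tabulate-zero _ right-row) ⟩
    sum (tabulate row-of-X) + 0
      ≡⟨ +-identityʳ _ ⟩
    sum (tabulate row-of-X)
      ≡⟨ ∣∣ₑ≡sum-tabulate X ⟨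
    ∣ X ∣ₑ ∎
    where
      open ≡-Reasoning
      row : Fin (2 * n) → ℕ
      row a = sum (tabulate λ b → 𝟙 (leftCopy X a b))
      row-of-X : Fin n → ℕ
      row-of-X u = sum (tabulate λ v → 𝟙 (X u v))
      left-row : ∀ u → row (left u) ≡ row-of-X u
      left-row u = begin
        row (left u)
          ≡⟨ sum-tabulate-↑ n (n + 0) _ ⟩
        sum (tabulate λ v → 𝟙 (leftCopy X (left u) (left v)))
          + sum (tabulate λ j → 𝟙 (leftCopy X (left u) (n ↑ʳ j)))
          ≡⟨ cong₂ _+_ (cong sum (tabulate-cong (cong 𝟙 ∘ leftCopy-left-left X u)))
                       (sum-tabulate-zero _ (cong 𝟙 ∘ leftCopy-↑ʳ-target X (left u))) ⟩
        row-of-X u + 0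
          ≡⟨ +-identityʳ _ ⟩
        row-of-X u ∎
      right-row : ∀ j → row (n ↑ʳ j) ≡ 0
      right-row j = sum-tabulate-zero _ (cong 𝟙 ∘ leftCopy-↑ʳ-source X j)

  queryFaults : EdgeSet n → Edge n → EdgeSet (2 * n)
  queryFaults F e = leftCopy (F ∪ₑ ｛ e ｝ₑ)

  module _ {H D : EdgeSet n} where

    leftCopy-⊆-detour : ∀ {X} → X ⊆ₑ H → leftCopy X ⊆ₑ detour H D
    leftCopy-⊆-detour {X} X⊆H a b ab∈ with side a | side b
    ... | is-left u | is-left v =
      trans (detour-left-left H D u v) (X⊆H u v (trans (sym (leftCopy-left-left X u v)) ab∈))
    ... | is-left u | is-mid v = contradiction (trans (sym ab∈) (leftCopy-↑ʳ-target X (left u) _)) λ ()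
    ... | is-mid v  | _        = contradiction (trans (sym ab∈) (leftCopy-↑ʳ-source X _ b)) λ ()

    detour-complete : ∀ {F e} → uncurry D e ≡ true → ∀ {s t} → Reach (H ∖ₑ F) s t →
      Reach (detour H D ∖ₑ queryFaults F e) (left s) (left t)
    detour-complete De here = here
    detour-complete {F} {e} De (step {a} {b} ab∈ p) with (a , b) ≟ₑ e
    ... | yes refl = step into-mid (step out-of-mid (detour-complete De p))
      where
        into-mid : (detour H D ∖ₑ queryFaults F e) (left a) (mid b) ≡ true
        into-mid = ∖ₑ-∈⁺ (detour H D) (queryFaults F e)
          (trans (detour-left-mid H D a b) De)
          (leftCopy-↑ʳ-target (F ∪ₑ ｛ e ｝ₑ) (left a) (fromFin b))
        out-of-mid : (detour H D ∖ₑ queryFaults F e) (mid b) (left b) ≡ true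
        out-of-mid = ∖ₑ-∈⁺ (detour H D) (queryFaults F e)
          (trans (detour-mid-left H D b b) (dec-true (b ≟ᶠ b) refl))
          (leftCopy-↑ʳ-source (F ∪ₑ ｛ e ｝ₑ) (fromFin b) (left b))
    ... | no ab≢e = step kept (detour-complete De p)
      where
        Hab×Fab : H a b ≡ true × F a b ≡ false
        Hab×Fab = ∖ₑ-∈⁻ H F ab∈
        kept : (detour H D ∖ₑ queryFaults F e) (left a) (left b) ≡ true
        kept = ∖ₑ-∈⁺ (detour H D) (queryFaults F e) (trans (detour-left-left H D a b) (proj₁ Hab×Fab))
          (trans (leftCopy-left-left (F ∪ₑ ｛ e ｝ₑ) a b)
                 (cong₂ _∨_ (proj₂ Hab×Fab) (dec-false ((a , b) ≟ₑ e) ab≢e)))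

    detour-sound : ∀ {F e} → uncurry D e ≡ false → D ⊆ₑ H → (∀ u v → D u v ≡ true → F u v ≡ false) →
      ∀ {s t} → Reach (detour H D ∖ₑ queryFaults F e) (left s) (left t) →
      Reach ((H -ₑ e) ∖ₑ F) s t
    detour-sound {F} {e} De D⊆H D∩F {s} {t} p =
      subst₂ (Reach ((H -ₑ e) ∖ₑ F)) (collapse-left s) (collapse-left t) (Reach-map collapse arc p)
      where
        arc : ∀ a b → (detour H D ∖ₑ queryFaults F e) a b ≡ true →
          ((H -ₑ e) ∖ₑ F) (collapse a) (collapse b) ≡ true ⊎ collapse a ≡ collapse b
        arc a b ab∈ with side a | side b | ∖ₑ-∈⁻ (detour H D) (queryFaults F e) ab∈
        ... | is-left u | is-left v | Huv , Quv
          rewrite collapse-left u | collapse-left v | detour-left-left H D u v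
                | leftCopy-left-left (F ∪ₑ ｛ e ｝ₑ) u v =
          inj₁ (∖ₑ-∈⁺ (H -ₑ e) F (∖ₑ-∈⁺ H ｛ e ｝ₑ Huv (∨-conicalʳ (F u v) _ Quv)) (∨-conicalˡ (F u v) _ Quv))
        ... | is-left u | is-mid v | Duv , _
          rewrite collapse-left u | collapse-mid v | detour-left-mid H D u v =
          inj₁ (∖ₑ-∈⁺ (H -ₑ e) F
                 (-ₑ-keeps H (D⊆H u v Duv) λ { refl → contradiction (trans (sym Duv) De) λ () })
                 (D∩F u v Duv))
        ... | is-mid v | is-left w | v≟w , _
          rewrite collapse-mid v | collapse-left w | detour-mid-left H D v w = inj₂ (from-does (v ≟ᶠ w) v≟w)
        ... | is-mid v | is-mid w | absurd , _ =
          contradiction (trans (sym absurd) (detour-mid-mid H D v w)) λ ()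

-- Bit strings

bitStrings : ℕ → List (List Bool)
bitStrings zero    = [] ∷ []
bitStrings (suc m) = map (true ∷_) (bitStrings m) ++ map (false ∷_) (bitStrings m)

length-bitStrings : ∀ m → length (bitStrings m) ≡ 2 ^ m
length-bitStrings zero    = refl
length-bitStrings (suc m) = begin
  length (map (true ∷_) (bitStrings m) ++ map (false ∷_) (bitStrings m))
    ≡⟨ length-++ (map (true ∷_) (bitStrings m)) ⟩
  length (map (true ∷_) (bitStrings m)) + length (map (false ∷_) (bitStrings m))
    ≡⟨ cong₂ _+_ (length-map (true ∷_) (bitStrings m)) (length-map (false ∷_) (bitStrings m)) ⟩
  length (bitStrings m) + length (bitStrings m)
    ≡⟨ cong (λ l → l + l) (length-bitStrings m) ⟩
  2 ^ m + 2 ^ m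
    ≡⟨ cong (2 ^ m +_) (+-identityʳ (2 ^ m)) ⟨
  2 ^ suc m ∎
  where open ≡-Reasoning

∈-bitStrings : ∀ w → w ∈ bitStrings (length w)
∈-bitStrings []          = here refl
∈-bitStrings (true ∷ w)  = ∈-++⁺ˡ (∈-map⁺ (true ∷_) (∈-bitStrings w))
∈-bitStrings (false ∷ w) = ∈-++⁺ʳ (map (true ∷_) (bitStrings (length w))) (∈-map⁺ (false ∷_) (∈-bitStrings w))

∈-bitStrings⁻ : ∀ m {w} → w ∈ bitStrings m → length w ≡ m
∈-bitStrings⁻ zero    (here refl) = refl
∈-bitStrings⁻ (suc m) w∈ with ∈-++⁻ (map (true ∷_) (bitStrings m)) w∈
... | inj₁ w∈ᵗ with ∈-map⁻ (true ∷_) w∈ᵗ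
...   | _ , w′∈ , refl = cong suc (∈-bitStrings⁻ m w′∈)
∈-bitStrings⁻ (suc m) w∈ | inj₂ w∈ᶠ with ∈-map⁻ (false ∷_) w∈ᶠ
...   | _ , w′∈ , refl = cong suc (∈-bitStrings⁻ m w′∈)

bitStrings-unique : ∀ m → Unique (bitStrings m)
bitStrings-unique zero    = [] ∷ []
bitStrings-unique (suc m) =
  ++⁺ (map⁺ ∷-injectiveʳ (bitStrings-unique m)) (map⁺ ∷-injectiveʳ (bitStrings-unique m)) disjoint
  where
    disjoint : ∀ {w} → w ∈ map (true ∷_) (bitStrings m) × w ∈ map (false ∷_) (bitStrings m) → ⊥
    disjoint (w∈ᵗ , w∈ᶠ) with ∈-map⁻ (true ∷_) w∈ᵗ | ∈-map⁻ (false ∷_) w∈ᶠ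
    ... | _ , _ , refl | _ , _ , ()

bitStrings≤ : ℕ → List (List Bool)
bitStrings≤ zero    = bitStrings zero
bitStrings≤ (suc o) = bitStrings (suc o) ++ bitStrings≤ o

∈-bitStrings≤ : ∀ o w → length w ≤ o → w ∈ bitStrings≤ o
∈-bitStrings≤ zero    [] _ = here refl
∈-bitStrings≤ (suc o) w w≤ with length w ≟ suc o
... | yes w≡ = ∈-++⁺ˡ (subst (λ l → w ∈ bitStrings l) w≡ (∈-bitStrings w))
... | no  w≢   = ∈-++⁺ʳ (bitStrings (suc o)) (∈-bitStrings≤ o w (≤-pred (≤∧≢⇒< w≤ w≢)))

length-bitStrings≤ : ∀ o → suc (length (bitStrings≤ o)) ≡ 2 ^ suc o
length-bitStrings≤ zero    = refl
length-bitStrings≤ (suc o) = begin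
  suc (length (bitStrings (suc o) ++ bitStrings≤ o))
    ≡⟨ cong suc (length-++ (bitStrings (suc o))) ⟩
  suc (length (bitStrings (suc o)) + length (bitStrings≤ o))
    ≡⟨ +-suc _ _ ⟨
  length (bitStrings (suc o)) + suc (length (bitStrings≤ o))
    ≡⟨ cong₂ _+_ (length-bitStrings (suc o)) (length-bitStrings≤ o) ⟩
  2 ^ suc o + 2 ^ suc o
    ≡⟨ cong (2 ^ suc o +_) (+-identityʳ (2 ^ suc o)) ⟨
  2 ^ suc (suc o) ∎
  where open ≡-Reasoning

injective-code-length : ∀ m o (code : List Bool → List Bool) →
  (∀ {σ} → σ ∈ bitStrings m → length (code σ) ≤ o) →
  (∀ {σ σ′} → σ ∈ bitStrings m → σ′ ∈ bitStrings m → code σ ≡ code σ′ → σ ≡ σ′) →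
  m ≤ o
injective-code-length m o code short injective with m ≤? o
... | yes m≤o = m≤o
... | no  m≰o = contradiction (^-monoʳ-≤ 2 (≰⇒> m≰o)) (<⇒≱ (begin-strict
  2 ^ m                         ≡⟨ length-bitStrings m ⟨
  length (bitStrings m)         ≤⟨ length-≤-injection (≡-dec-List _≟ᵇ_) code (bitStrings m) (bitStrings≤ o)
                                     (bitStrings-unique m) injective (λ σ∈ → ∈-bitStrings≤ o _ (short σ∈)) ⟩
  length (bitStrings≤ o)        <⟨ n<1+n _ ⟩
  suc (length (bitStrings≤ o))  ≡⟨ length-bitStrings≤ o ⟩
  2 ^ suc o                     ∎))
  where open ≤-Reasoning

-- Encoding subsets of independent essential edges

module Selection {A : Set} (_≟_ : DecidableEquality A) where

  select : List A → List Bool → A → Bool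
  select (y ∷ ys) (b ∷ bs) x = (b ∧ does (y ≟ x)) ∨ select ys bs x
  select _        _        x = false

  select-∈ : ∀ S σ {x} → select S σ x ≡ true → x ∈ S
  select-∈ (y ∷ ys) (b ∷ bs) {x} chosen with y ≟ x
  ... | yes refl = here refl
  ... | no  _    = there (select-∈ ys bs (trans (sym (cong (_∨ select ys bs x) (∧-zeroʳ b))) chosen))

  select-∉ : ∀ S σ {x} → x ∉ S → select S σ x ≡ false
  select-∉ S σ {x} x∉S with select S σ x in chosen
  ... | false = refl
  ... | true  = contradiction (select-∈ S σ chosen) x∉S

  select-head : ∀ {y ys} b bs → y ∉ ys → select (y ∷ ys) (b ∷ bs) y ≡ b
  select-head {y} {ys} b bs y∉ys
    rewrite dec-true (y ≟ y) refl | select-∉ ys bs y∉ys = trans (∨-identityʳ (b ∧ true)) (∧-identityʳ b)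

  select-tail : ∀ {y ys x} b bs → y ≢ x → select (y ∷ ys) (b ∷ bs) x ≡ select ys bs x
  select-tail {y} {x = x} b bs y≢x rewrite dec-false (y ≟ x) y≢x | ∧-zeroʳ b = refl

  select-separates : ∀ S σ σ′ → Unique S → length σ ≡ length S → length σ′ ≡ length S → σ ≢ σ′ →
    ∃[ x ] x ∈ S × select S σ x ≢ select S σ′ x
  select-separates []       []       []         _           _ _ σ≢σ′ = contradiction refl σ≢σ′
  select-separates (y ∷ ys) (b ∷ bs) (b′ ∷ bs′) (y∉ ∷ uys) ∣σ∣ ∣σ′∣ σ≢σ′ with b ≟ᵇ b′
  ... | no b≢b′ = y , here refl , λ same →
    b≢b′ (trans (sym (select-head b bs y∉ys)) (trans same (select-head b′ bs′ y∉ys)))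
    where
      y∉ys : y ∉ ys
      y∉ys y∈ys = All.lookup y∉ y∈ys refl
  ... | yes refl
    with select-separates ys bs bs′ uys (suc-injective ∣σ∣) (suc-injective ∣σ′∣) (σ≢σ′ ∘ cong (b ∷_))
  ...   | x , x∈ys , differ = x , there x∈ys , λ same →
    differ (trans (sym (select-tail {ys = ys} b bs (y≢x x∈ys)))
                  (trans same (select-tail {ys = ys} b bs′ (y≢x x∈ys))))
    where
      y≢x : x ∈ ys → y ≢ x
      y≢x x∈ys = All.lookup y∉ x∈ys

module Encoding {n d o : ℕ} {P H : EdgeSet n}
  (oracle : OracleScheme (2 * n) ∣ P ∣ₑ (suc d) o)
  (certify : ∀ e → Essential d P H e ⊎ uncurry H e ≡ false) where

  open Doubling n
  open Selection (_≟ₑ_ {n})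
  open Essential

  faultsOf : Edge n → EdgeSet n
  faultsOf e = [ faults , (λ _ → ∅ₑ) ] (certify e)

  few-faultsOf : ∀ e → ∣ faultsOf e ∣ₑ ≤ d
  few-faultsOf e with certify e
  ... | inj₁ w = few-faults w
  ... | inj₂ _ = ≤-trans (≤-reflexive (∣∅ₑ∣ₑ {n})) z≤n

  essential : ∀ {e} → e ∈ edgeList H → Σ[ w ∈ Essential d P H e ] faultsOf e ≡ faults w
  essential {e} e∈ with certify e
  ... | inj₁ w      = w , refl
  ... | inj₂ absent = contradiction (trans (sym (∈-edgeList⁻ H e∈)) absent) λ ()

  open IndependentSet (_≟ₑ_ {n}) (λ x → uncurry (faultsOf x)) d
  open IndependentSubset (independentSubset (edgeList H) (edgeList-unique H)
                           (λ x → ≤-trans (count-edgeList≤∣∣ₑ (faultsOf x) H) (few-faultsOf x)))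

  selected : List Bool → EdgeSet n
  selected σ u v = select members σ (u , v)

  selected-⊆ : ∀ σ → selected σ ⊆ₑ H
  selected-⊆ σ u v uv∈ = ∈-edgeList⁻ H (⊆L (select-∈ members σ uv∈))

  query : List Bool → Fin (2 * n) → Fin (2 * n) → EdgeSet (2 * n) → Bool
  query = proj₁ oracle

  code : List Bool → List Bool
  code σ = proj₁ (proj₂ oracle (detour H (selected σ)) (leftCopy P) (∣leftCopy∣ₑ P))

  code-short : ∀ σ → length (code σ) ≤ o
  code-short σ = proj₁ (proj₂ (proj₂ oracle (detour H (selected σ)) (leftCopy P) (∣leftCopy∣ₑ P)))

  code-correct : ∀ σ s t → leftCopy P s t ≡ true → ∀ F → F ⊆ₑ detour H (selected σ) → ∣ F ∣ₑ ≤ suc d →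
    (query (code σ) s t F ≡ true) ⇔ Reach (detour H (selected σ) ∖ₑ F) s t
  code-correct σ = proj₂ (proj₂ (proj₂ oracle (detour H (selected σ)) (leftCopy P) (∣leftCopy∣ₑ P)))

  module _ {e} (e∈ : e ∈ members) where

    private
      w : Essential d P H e
      w = proj₁ (essential (⊆L e∈))
      s t : Fin n
      s = source w
      t = target w
      F : EdgeSet n
      F = faults w
      Q : EdgeSet (2 * n)
      Q = queryFaults F e
      He : uncurry H e ≡ true
      He = ∈-edgeList⁻ H (⊆L e∈)

      answer : ∀ σ → (query (code σ) (left s) (left t) Q ≡ true) ⇔
                     Reach (detour H (selected σ) ∖ₑ Q) (left s) (left t)
      answer σ = code-correct σ (left s) (left t) (trans (leftCopy-left-left P s t) (demanded w))
        Q (leftCopy-⊆-detour (∪ₑ-⊆ (faults⊆H w) (｛｝ₑ-⊆ He)))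
        (≤-trans (≤-reflexive (∣leftCopy∣ₑ (F ∪ₑ ｛ e ｝ₑ))) (≤-trans (∣∪ₑ｛｝ₑ∣≤ F e) (s≤s (few-faults w))))

      avoids-faults : ∀ σ′ → select members σ′ e ≡ false → ∀ u v → selected σ′ u v ≡ true → F u v ≡ false
      avoids-faults σ′ e∉σ′ u v uv∈ =
        trans (cong (λ X → X u v) (sym (proj₂ (essential (⊆L e∈)))))
              (independent e∈ (select-∈ members σ′ uv∈)
                           λ { refl → contradiction (trans (sym uv∈) e∉σ′) λ () })

    code-separates : ∀ σ σ′ → select members σ e ≡ true → select members σ′ e ≡ false → code σ ≢ code σ′
    code-separates σ σ′ e∈σ e∉σ′ same = cut w
      (detour-sound e∉σ′ (selected-⊆ σ′) (avoids-faults σ′ e∉σ′)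
        (proj₁ (answer σ′) (subst (λ c → query c (left s) (left t) Q ≡ true) same
          (proj₂ (answer σ) (detour-complete e∈σ (survives w))))))

  code-injective : ∀ {σ σ′} → σ ∈ bitStrings (length members) → σ′ ∈ bitStrings (length members) →
    code σ ≡ code σ′ → σ ≡ σ′
  code-injective {σ} {σ′} σ∈ σ′∈ same = decidable-stable (≡-dec-List _≟ᵇ_ σ σ′) λ σ≢σ′ →
    let e , e∈ , differ = select-separates members σ σ′ unique (∈-bitStrings⁻ _ σ∈) (∈-bitStrings⁻ _ σ′∈) σ≢σ′
    in [ (λ (σe , σ′e) → code-separates e∈ σ σ′ σe σ′e same)
       , (λ (σe , σ′e) → code-separates e∈ σ′ σ σ′e σe (sym same))
       ] (≢⇒opposite differ)

  ∣H∣ₑ≤ : ∣ H ∣ₑ ≤ suc (d + d) * o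
  ∣H∣ₑ≤ = begin
    ∣ H ∣ₑ                        ≡⟨ length-edgeList H ⟨
    length (edgeList H)           ≤⟨ large ⟩
    suc (d + d) * length members  ≤⟨ *-monoʳ-≤ (suc (d + d)) members≤o ⟩
    suc (d + d) * o               ∎
    where
      open ≤-Reasoning
      members≤o : length members ≤ o
      members≤o = injective-code-length _ o code (λ {σ} _ → code-short σ) code-injective

-- Minimality provides the essential witnesses only under double negation, which suffices because
-- the conclusion is decidable.
minFTRS-size≤ : ∀ {n d m o} {G P : EdgeSet n} → IsMinFTRS d G P m →
  OracleScheme (2 * n) ∣ P ∣ₑ (suc d) o → m ≤ suc (d + d) * o
minFTRS-size≤ {n} {d} {_} {o} {G} {P} ((H , H-ftrs , refl) , minimum) oracle =
  decidable-stable (∣ H ∣ₑ ≤? suc (d + d) * o) (¬¬-map (Encoding.∣H∣ₑ≤ oracle) certified)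
  where
    certify : ∀ e → ¬ ¬ (Essential d P H e ⊎ uncurry H e ≡ false)
    certify e with uncurry H e in He
    ... | true  = ¬¬-map inj₁ (minimum⇒essential H-ftrs minimum He)
    ... | false = λ none → none (inj₂ refl)
    certified : ¬ ¬ (∀ e → Essential d P H e ⊎ uncurry H e ≡ false)
    certified = ¬¬-map (λ all e → All.lookup all (∈-allEdges e))
                       (All.sequenceM 0ℓ ¬¬-Monad (All.tabulate (λ {e} _ → certify e)))

theorem8p5 : Σ ℕ λ c → 1 ≤ c ×
    (∀ (n k p : ℕ) → 1 ≤ n → 1 ≤ k →
    ∀ (s o : ℕ) → IsS n p (k ∸ 1) s → IsO (2 * n) p k o →
    s ≤ c * k * o)
theorem8p5 = 2 , s≤s z≤n , bound
  where
    1+2d≤2[1+d] : ∀ d → suc (d + d) ≤ 2 * suc d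
    1+2d≤2[1+d] d = ≤-trans (n≤1+n _) (≤-reflexive (cong suc
      (trans (sym (+-suc d d)) (cong (λ x → d + suc x) (sym (+-identityʳ d))))))
    bound : ∀ n k p → 1 ≤ n → 1 ≤ k → ∀ s o → IsS n p (k ∸ 1) s → IsO (2 * n) p k o → s ≤ 2 * k * o
    bound n (suc d) p _ _ s o (_ , least) (oracle , _) = least (2 * suc d * o)
      λ G P ∣P∣≡p m min → ≤-trans
        (minFTRS-size≤ min (subst (λ q → OracleScheme (2 * n) q (suc d) o) (sym ∣P∣≡p) oracle))
        (*-monoˡ-≤ o (1+2d≤2[1+d] d))
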